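{- There is a mapping $\Phi :\mathfrak{M}\rightarrow \mathfrak{M_H}$ such that for every $I\in \mathfrak{M}$, $\Phi (I)\supseteq I$ and $\Phi (I)\approx _{\mathrm{sep}} I$.
   Context: All ideals on $\omega$ considered contain every finite subset of $\omega$; ideals are identified with subsets of the Cantor space $2^\omega$. $\mathfrak{M}$ is the set of ideals on $\omega$ that are meager subsets of $2^\omega$, ordered by reverse inclusion $\supseteq$ (a larger ideal is a stronger condition). For an ideal $I$ and $X\subseteq\omega$ with $X\notin I$, $I\upharpoonright X=\{A\in I: A\subseteq X\}$; $I$ is hereditary meager if $I\upharpoonright X$ is meager in $2^X$ for every $X\subseteq\omega$ with $X\notin I$. $\mathfrak{M_H}$ is the set of hereditary meager ideals. Two meager ideals are compatible if some meager ideal contains both. For $I,J\in\mathfrak{M}$, $I\approx_{\mathrm{sep}}J$ means: for every $K\in\mathfrak{M}$, $K$ is incompatible with $I$ iff $K$ is incompatible with $J$. -}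

module Defs where

open import Level using (0ℓ)
open import Data.Nat using (ℕ; zero; suc; _≤_)
open import Data.Bool using (Bool; true; false; _∨_)
open import Data.List using (List; []; _∷_; _++_)
open import Data.Product using (Σ; ∃; _×_; _,_)
open import Data.Unit using (⊤)
open import Relation.Nullary using (¬_)
open import Relation.Binary.PropositionalEquality using (_≡_)
open import Function using (_∘_)
open import Function.Bundles using (_⇔_)

-- Points of the Cantor space 2^ω = characteristic functions of subsets of ω.
Cantor : Set
Cantor = ℕ → Bool

PSet : Set₁
PSet = Cantor → Set

ω : Cantor
ω = λ _ → true

_⊆_ : Cantor → Cantor → Set
A ⊆ B = ∀ n → A n ≡ true → B n ≡ true

_∪_ : Cantor → Cantor → Cantor
(A ∪ B) n = A n ∨ B n

Finite : Cantor → Set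
Finite A = ∃ λ N → ∀ n → N ≤ n → A n ≡ false

_⊑_ : PSet → PSet → Set
I ⊑ J = ∀ A → I A → J A

record IsIdeal (I : PSet) : Set where
  field
    downward : ∀ A B → B ⊆ A → I A → I B
    unionClosed : ∀ A B → I A → I B → I (A ∪ B)
    finiteSets : ∀ A → Finite A → I A
    proper : ¬ I ω

-- x lies in the basic clopen set [s] determined by the finite binary string s
Extends : Cantor → List Bool → Set
Extends x [] = ⊤
Extends x (b ∷ s) = (x 0 ≡ b) × Extends (x ∘ suc) s

-- [s] meets the closed subspace 2^X = {A : A ⊆ X}
Compat : Cantor → List Bool → Set
Compat X [] = ⊤
Compat X (b ∷ s) = (b ≡ true → X 0 ≡ true) × Compat (X ∘ suc) s

NowhereDenseIn : Cantor → PSet → Set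
NowhereDenseIn X F =
  ∀ s → Compat X s →
    ∃ λ t → Compat X (s ++ t) × (∀ x → x ⊆ X → Extends x (s ++ t) → ¬ F x)

MeagerIn : Cantor → PSet → Set₁
MeagerIn X S =
  Σ (ℕ → PSet) λ F → (∀ n → NowhereDenseIn X (F n)) × (∀ x → x ⊆ X → S x → ∃ λ n → F n x)

Meager : PSet → Set₁
Meager S = MeagerIn ω S

Restrict : PSet → Cantor → PSet
Restrict I X A = I A × A ⊆ X

HereditaryMeager : PSet → Set₁
HereditaryMeager I = ∀ X → ¬ I X → MeagerIn X (Restrict I X)

record MIdeal : Set₁ where
  field
    carrier : PSet
    isIdeal : IsIdeal carrier
    meager : Meager carrier
open MIdeal public

Compatible : MIdeal → MIdeal → Set₁
Compatible I J = Σ MIdeal λ K → (carrier I ⊑ carrier K) × (carrier J ⊑ carrier K)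

_≈sep_ : MIdeal → MIdeal → Set₁
I ≈sep J = ∀ (K : MIdeal) → (¬ Compatible K I) ⇔ (¬ Compatible K J)

module Submission where

-- Φ I is the "hull" of I, defined through block sequences.  A block sequence in
-- X is a sequence of nonempty finite sets block k ⊆ X lying above k; x captures it
-- if x contains infinitely many blocks, and I avoids it in X if no member of I
-- inside X captures it.  Hull I consists of the A such that I avoids no block
-- sequence in A.

open import Defs
open import Level using (0ℓ)
open import Data.Product using (Σ; _×_)
open import Axiom.ExcludedMiddle using (ExcludedMiddle)
open import Level using (Lift; lift; lower)
open import Data.Nat using (ℕ; zero; suc; _+_; _∸_; _≤_; _<_; z≤n; s≤s)
open import Data.Nat.Properties
open import Data.Bool using (Bool; true; false; _∨_; _∧_)
open import Data.Bool.Properties using (∧-conicalˡ; ∧-conicalʳ; ∧-zeroʳ; ∨-zeroʳ; ∨-comm; ¬-not)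
open import Data.List using (List; []; _∷_; _++_; length; map; cartesianProduct; upTo)
open import Data.List.Properties using (++-assoc)
open import Data.List.Relation.Unary.All as All using (All; []; _∷_)
open import Data.List.Relation.Unary.Any using (here)
open import Data.List.Membership.Propositional using (_∈_)
open import Data.List.Membership.Propositional.Properties
  using (∈-cartesianProduct⁺; ∈-upTo⁺; ∈-++⁺ˡ; ∈-++⁺ʳ; ∈-map⁺)
open import Data.Product using (∃; _,_; proj₁; proj₂)
open import Data.Sum using (_⊎_; inj₁; inj₂)
open import Data.Unit using (tt)
open import Data.Empty using (⊥; ⊥-elim)
open import Relation.Nullary using (¬_; Dec; yes; no)
open import Relation.Binary using (tri<; tri≈; tri>)
open import Relation.Binary.PropositionalEquality using (_≡_; refl; sym; trans; cong; subst)
open import Function using (_∘_)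
open import Function.Bundles using (mk⇔)

∧-intro : ∀ {a b} → a ≡ true → b ≡ true → a ∧ b ≡ true
∧-intro refl refl = refl

∨-introˡ : ∀ {a b} → a ≡ true → a ∨ b ≡ true
∨-introˡ refl = refl

∨-introʳ : ∀ {a b} → b ≡ true → a ∨ b ≡ true
∨-introʳ {a} refl = ∨-zeroʳ a

∨-resolveˡ : ∀ {a b} → a ∨ b ≡ true → b ≡ false → a ≡ true
∨-resolveˡ {true} _ _ = refl
∨-resolveˡ {false} e refl = e

∨-resolveʳ : ∀ {a b} → a ∨ b ≡ true → a ≡ false → b ≡ true
∨-resolveʳ {false} e refl = e

true≢false : ¬ (true ≡ false)
true≢false ()

_∩_ : Cantor → Cantor → Cantor
(A ∩ B) n = A n ∧ B n

Meets : Cantor → Cantor → Set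
Meets p C = ∃ λ n → p n ≡ true × C n ≡ true

⊆-trans : ∀ {A B C} → A ⊆ B → B ⊆ C → A ⊆ C
⊆-trans A⊆B B⊆C n = B⊆C n ∘ A⊆B n

∩-⊆ˡ : ∀ A B → (A ∩ B) ⊆ A
∩-⊆ˡ A B n = ∧-conicalˡ _ _

∩-⊆ʳ : ∀ A B → (A ∩ B) ⊆ B
∩-⊆ʳ A B n = ∧-conicalʳ _ _

⊆-∪ˡ : ∀ A B → A ⊆ (A ∪ B)
⊆-∪ˡ A B n = ∨-introˡ

⊆-∪ʳ : ∀ A B → B ⊆ (A ∪ B)
⊆-∪ʳ A B n = ∨-introʳ

∪-swap : ∀ {p} A B → p ⊆ (A ∪ B) → p ⊆ (B ∪ A)
∪-swap A B p⊆ n pn = trans (∨-comm (B n) (A n)) (p⊆ n pn)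

∪-mono : ∀ {x y A B} → x ⊆ A → y ⊆ B → (x ∪ y) ⊆ (A ∪ B)
∪-mono {x} x⊆A y⊆B n e with x n in xn
... | true = ∨-introˡ (x⊆A n xn)
... | false = ∨-introʳ (y⊆B n e)

∩-⊆-whole : ∀ {p C y} → p ⊆ C → (p ∩ C) ⊆ y → p ⊆ y
∩-⊆-whole p⊆C part n pn = part n (∧-intro pn (p⊆C n pn))

∪-split : ∀ {p x y} A B → p ⊆ (A ∪ B) → (p ∩ A) ⊆ x → (p ∩ B) ⊆ y → p ⊆ (x ∪ y)
∪-split A B p⊆ inX inY n pn with A n in an
... | true = ∨-introˡ (inX n (∧-intro pn an))
... | false = ∨-introʳ (inY n (∧-intro pn (∨-resolveʳ (p⊆ n pn) an)))

misses-⊆ : ∀ {p} A B → p ⊆ (A ∪ B) → ¬ Meets p B → p ⊆ A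
misses-⊆ A B p⊆ miss n pn with B n in bn
... | true = ⊥-elim (miss (n , pn , bn))
... | false = ∨-resolveˡ (p⊆ n pn) bn

shift : ℕ → Cantor → Cantor
shift n x m = x (n + m)

prefix : Cantor → ℕ → List Bool
prefix x zero = []
prefix x (suc m) = x 0 ∷ prefix (x ∘ suc) m

bit : List Bool → ℕ → Bool
bit [] _ = false
bit (b ∷ s) zero = b
bit (b ∷ s) (suc i) = bit s i

extends-split : ∀ x s t → Extends x (s ++ t) → Extends x s × Extends (shift (length s) x) t
extends-split x [] t e = tt , e
extends-split x (b ∷ s) t (e₀ , e) with extends-split (x ∘ suc) s t e
... | es , et = (e₀ , es) , et

extends-++ˡ : ∀ x s t → Extends x (s ++ t) → Extends x s
extends-++ˡ x s t = proj₁ ∘ extends-split x s t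

extends-++ : ∀ x s t → Extends x s → Extends (shift (length s) x) t → Extends x (s ++ t)
extends-++ x [] t _ et = et
extends-++ x (b ∷ s) t (e₀ , es) et = e₀ , extends-++ (x ∘ suc) s t es et

compat-++ : ∀ X s t → Compat X s → Compat (shift (length s) X) t → Compat X (s ++ t)
compat-++ X [] t _ ct = ct
compat-++ X (b ∷ s) t (c₀ , cs) ct = c₀ , compat-++ (X ∘ suc) s t cs ct

compat-ω : ∀ s → Compat ω s
compat-ω [] = tt
compat-ω (b ∷ s) = (λ _ → refl) , compat-ω s

compat-prefix : ∀ Y f m → f ⊆ Y → Compat Y (prefix f m)
compat-prefix Y f zero _ = tt
compat-prefix Y f (suc m) f⊆Y = f⊆Y 0 , compat-prefix (Y ∘ suc) (f ∘ suc) m (f⊆Y ∘ suc)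

extends-prefix : ∀ x m → Extends x (prefix x m)
extends-prefix x zero = tt
extends-prefix x (suc m) = refl , extends-prefix (x ∘ suc) m

length-prefix : ∀ x m → length (prefix x m) ≡ m
length-prefix x zero = refl
length-prefix x (suc m) = cong suc (length-prefix (x ∘ suc) m)

prefix-agree : ∀ y f m → Extends y (prefix f m) → ∀ i → i < m → y i ≡ f i
prefix-agree y f (suc m) (e₀ , e) zero _ = e₀
prefix-agree y f (suc m) (e₀ , e) (suc i) (s≤s i<m) = prefix-agree (y ∘ suc) (f ∘ suc) m e i i<m

extends-bits : ∀ y s → (∀ i → i < length s → y i ≡ bit s i) → Extends y s
extends-bits y [] _ = tt
extends-bits y (b ∷ s) agree =
  agree 0 (s≤s z≤n) , extends-bits (y ∘ suc) s (λ i i< → agree (suc i) (s≤s i<))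

bit-true : ∀ s i → bit s i ≡ true → i < length s
bit-true (b ∷ s) zero _ = s≤s z≤n
bit-true (b ∷ s) (suc i) e = s≤s (bit-true s i e)

bit-last : ∀ s → bit (s ++ true ∷ []) (length s) ≡ true
bit-last [] = refl
bit-last (b ∷ s) = bit-last s

window-⊆ : ∀ x s p m → Extends x (s ++ prefix (shift (length s) p) m) →
           (∀ n → p n ≡ true → length s ≤ n × n < length s + m) → p ⊆ x
window-⊆ x s p m e inWindow n pn with inWindow n pn
... | ℓ≤n , n<ℓ+m with m≤n⇒∃[o]m+o≡n ℓ≤n
...   | i , refl = trans (prefix-agree (shift ℓ x) (shift ℓ p) m tail i i<m) pn
  where
  ℓ = length s
  tail = proj₂ (extends-split x s _ e)
  i<m = +-cancelˡ-< ℓ i m n<ℓ+m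

Infinitely : (ℕ → Set) → Set
Infinitely Q = ∀ N → ∃ λ k → N ≤ k × Q k

Eventually : (ℕ → Set) → Set
Eventually Q = ∃ λ M → ∀ k → M ≤ k → Q k

infinitely-map : ∀ {Q R : ℕ → Set} → (∀ {k} → Q k → R k) → Infinitely Q → Infinitely R
infinitely-map f inf N = let (k , N≤k , q) = inf N in k , N≤k , f q

eventually⇒infinitely : ∀ {Q} → Eventually Q → Infinitely Q
eventually⇒infinitely (M , ev) N = N + M , m≤m+n N M , ev (N + M) (m≤n+m M N)

infinitely-∩-eventually : ∀ {Q R} → Infinitely Q → Eventually R → Infinitely (λ k → Q k × R k)
infinitely-∩-eventually inf (M , ev) N =
  let (k , N+M≤k , q) = inf (N + M) in
  k , ≤-trans (m≤m+n N M) N+M≤k , q , ev k (≤-trans (m≤n+m M N) N+M≤k)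

record Blocks (X : Cantor) : Set where
  field
    block : ℕ → Cantor
    bound : ℕ → ℕ
    block⊆X : ∀ k → block k ⊆ X
    block-above : ∀ k n → block k n ≡ true → k ≤ n
    block-below : ∀ k n → block k n ≡ true → n < bound k
    block-nonempty : ∀ k → ∃ λ n → block k n ≡ true
open Blocks public

Captures : ∀ {X} → Blocks X → Cantor → Set
Captures S x = Infinitely (λ k → block S k ⊆ x)

Avoids : PSet → (X : Cantor) → Blocks X → Set
Avoids I X S = ∀ x → I x → x ⊆ X → ¬ Captures S x

-- A finite set carries no block sequence: block N lies above the last point.
finite-no-blocks : ∀ {A} → Finite A → ¬ Blocks A
finite-no-blocks (N , empty) S with block-nonempty S N
... | n , inBlock =
  true≢false (trans (sym (block⊆X S N n inBlock)) (empty n (block-above S N n inBlock)))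

widen : ∀ {X Y} → X ⊆ Y → Blocks X → Blocks Y
widen X⊆Y S = record
  { block = block S ; bound = bound S ; block⊆X = λ k → ⊆-trans (block⊆X S k) X⊆Y
  ; block-above = block-above S ; block-below = block-below S ; block-nonempty = block-nonempty S }

restrict : ∀ {X} (S : Blocks X) (C : Cantor) {R : ℕ → Set} →
           Infinitely R → (∀ {k} → R k → Meets (block S k) C) → Blocks C
restrict S C {R} inf meets = record
  { block = λ j → block S (pick j) ∩ C
  ; bound = λ j → bound S (pick j)
  ; block⊆X = λ j → ∩-⊆ʳ (block S (pick j)) C
  ; block-above = λ j n e → ≤-trans (pick-≥ j) (block-above S (pick j) n (inPicked j n e))
  ; block-below = λ j n e → block-below S (pick j) n (inPicked j n e)
  ; block-nonempty = λ j → let (n , inBlock , inC) = meets (picked j) in n , ∧-intro inBlock inC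
  }
  where
  pick : ℕ → ℕ
  pick j = proj₁ (inf j)
  pick-≥ : ∀ j → j ≤ pick j
  pick-≥ j = proj₁ (proj₂ (inf j))
  picked : ∀ j → R (pick j)
  picked j = proj₂ (proj₂ (inf j))
  inPicked : ∀ j → (block S (pick j) ∩ C) ⊆ block S (pick j)
  inPicked j = ∩-⊆ˡ (block S (pick j)) C

restrict-captured : ∀ {X} (S : Blocks X) C {R} (inf : Infinitely R)
                    (meets : ∀ {k} → R k → Meets (block S k) C) {y} →
                    Captures (restrict S C inf meets) y → Infinitely (λ k → R k × (block S k ∩ C) ⊆ y)
restrict-captured S C inf meets cap N =
  let (j , N≤j , part) = cap N ; (k , j≤k , r) = inf j in
  k , ≤-trans N≤j j≤k , r , part

DownwardClosed : PSet → Set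
DownwardClosed I = ∀ A B → B ⊆ A → I A → I B

Hull : PSet → PSet
Hull I A = ∀ (S : Blocks A) → ¬ Avoids I A S

hull-⊇ : ∀ I → I ⊑ Hull I
hull-⊇ I A IA S avoids = avoids A IA (λ _ e → e) (λ N → N , ≤-refl , block⊆X S N)

hull-mono : ∀ {I L} → I ⊑ L → Hull I ⊑ Hull L
hull-mono I⊑L A hullA S avoidsL = hullA S (λ x Ix → avoidsL x (I⊑L x Ix))

hull-finite : ∀ I A → Finite A → Hull I A
hull-finite I A fin S = ⊥-elim (finite-no-blocks fin S)

hull-downward : ∀ I → DownwardClosed I → ∀ A B → B ⊆ A → Hull I A → Hull I B
hull-downward I downward A B B⊆A hullA S avoidsB = hullA (widen B⊆A S) avoidsA
  where
  avoidsA : Avoids I A (widen B⊆A S)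
  avoidsA x Ix _ cap = avoidsB (x ∩ B) (downward x (x ∩ B) (∩-⊆ˡ x B) Ix) (∩-⊆ʳ x B)
    (infinitely-map (λ {k} sub n e → ∧-intro (sub n e) (block⊆X S k n e)) cap)

-- The key fact: if I avoids S in X, no member of Hull I captures S, since each
-- captured subsequence is itself avoided by I.
avoided-not-captured : ∀ I {X} (S : Blocks X) x →
                       Avoids I X S → x ⊆ X → Captures S x → ¬ Hull I x
avoided-not-captured I {X} S x avoids x⊆X cap hullx = hullx Sx avoidsSx
  where
  meets : ∀ {k} → block S k ⊆ x → Meets (block S k) x
  meets {k} sub = let (n , inBlock) = block-nonempty S k in n , inBlock , sub n inBlock
  Sx = restrict S x cap meets
  avoidsSx : Avoids I x Sx
  avoidsSx y Iy y⊆x capY = avoids y Iy (⊆-trans y⊆x x⊆X)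
    (infinitely-map (λ (sub , part) → ∩-⊆-whole sub part) (restrict-captured S x cap meets capY))

≈sep-of-closure : (Ψ : MIdeal → MIdeal) →
                  (∀ I → carrier I ⊑ carrier (Ψ I)) →
                  (∀ I L → carrier I ⊑ carrier L → carrier (Ψ I) ⊑ carrier (Ψ L)) →
                  ∀ I → Ψ I ≈sep I
≈sep-of-closure Ψ inflate mono I K = mk⇔ toI fromI
  where
  toI : ¬ Compatible K (Ψ I) → ¬ Compatible K I
  toI incompat (L , K⊑L , I⊑L) = incompat (Ψ L , (λ A a → inflate L A (K⊑L A a)) , mono I L I⊑L)
  fromI : ¬ Compatible K I → ¬ Compatible K (Ψ I)
  fromI incompat (L , K⊑L , ΨI⊑L) = incompat (L , K⊑L , λ A a → ΨI⊑L A (inflate I A a))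

MissesFrom : ∀ {X} → Blocks X → ℕ → PSet
MissesFrom S N x = ∀ k → N ≤ k → ¬ (block S k ⊆ x)

-- Extending any string s by the pattern of block N + |s| forces that block in.
missesFrom-nowhereDense : ∀ {X} (S : Blocks X) N → NowhereDenseIn X (MissesFrom S N)
missesFrom-nowhereDense {X} S N s s-ok = t , compat-++ X s t s-ok t-ok , forced
  where
  ℓ = length s
  k = N + ℓ
  m = bound S k ∸ ℓ
  t = prefix (shift ℓ (block S k)) m
  t-ok : Compat (shift ℓ X) t
  t-ok = compat-prefix (shift ℓ X) (shift ℓ (block S k)) m (λ n → block⊆X S k (ℓ + n))
  inWindow : ∀ n → block S k n ≡ true → ℓ ≤ n × n < ℓ + m
  inWindow n e = ≤-trans (m≤n+m ℓ N) (block-above S k n e) ,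
                 <-≤-trans (block-below S k n e) (m≤n+m∸n (bound S k) ℓ)
  forced : ∀ x → x ⊆ X → Extends x (s ++ t) → ¬ MissesFrom S N x
  forced x _ e misses = misses k (m≤m+n N ℓ) (window-⊆ x s (block S k) m e inWindow)

-- Talagrand's construction: a downward closed meager family avoids a block sequence
-- in ω.  Block k lives on a window of ω whose pattern, read after any possible prefix,
-- leaves each of F 0, …, F k; a member x of I capturing infinitely many blocks would
-- make x ∩ (all blocks) leave its own F j.

module Talagrand (I : PSet) (downward : DownwardClosed I) (meagerI : Meager I) where

  F : ℕ → PSet
  F = proj₁ meagerI

  nowhereDense : ∀ j → NowhereDenseIn ω (F j)
  nowhereDense = proj₁ (proj₂ meagerI)

  covers : ∀ x → x ⊆ ω → I x → ∃ λ j → F j x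
  covers = proj₂ (proj₂ meagerI)

  -- Requirement (u , j): after the prefix u, the continuation must leave F j.
  Requirement : Set
  Requirement = List Bool × ℕ

  Settles : Requirement → List Bool → Set
  Settles (u , j) t = ∀ x → Extends x (u ++ t) → ¬ F j x

  settle : List Requirement → List Bool
  settle [] = []
  settle ((u , j) ∷ rs) = settle rs ++ proj₁ (nowhereDense j (u ++ settle rs) (compat-ω _))

  settles-++ : ∀ r t d → Settles r t → Settles r (t ++ d)
  settles-++ (u , j) t d settled x e =
    settled x (extends-++ˡ x (u ++ t) d (subst (Extends x) (sym (++-assoc u t d)) e))

  settle-all : ∀ rs → All (λ r → Settles r (settle rs)) rs
  settle-all [] = []
  settle-all ((u , j) ∷ rs) = new ∷ All.map (λ {r} → settles-++ r (settle rs) _) (settle-all rs)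
    where
    ext = nowhereDense j (u ++ settle rs) (compat-ω _)
    new : Settles (u , j) (settle rs ++ proj₁ ext)
    new x e = proj₂ (proj₂ ext) x (λ _ _ → refl)
                (subst (Extends x) (sym (++-assoc u (settle rs) (proj₁ ext))) e)

  strings : ℕ → List (List Bool)
  strings zero = [] ∷ []
  strings (suc n) = map (true ∷_) (strings n) ++ map (false ∷_) (strings n)

  prefix-∈-strings : ∀ x n → prefix x n ∈ strings n
  prefix-∈-strings x zero = here refl
  prefix-∈-strings x (suc n) with x 0
  ... | true = ∈-++⁺ˡ (∈-map⁺ (true ∷_) (prefix-∈-strings (x ∘ suc) n))
  ... | false = ∈-++⁺ʳ (map (true ∷_) (strings n))
                  (∈-map⁺ (false ∷_) (prefix-∈-strings (x ∘ suc) n))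

  -- Block k starting at position L settles every prefix of length L against every F j, j ≤ k.
  requirements : ℕ → ℕ → List Requirement
  requirements k L = cartesianProduct (strings L) (upTo (suc k))

  motif : ℕ → ℕ → List Bool
  motif k L = settle (requirements k L) ++ true ∷ []

  start : ℕ → ℕ
  start zero = 0
  start (suc k) = start k + length (motif k (start k))

  motifAt : ℕ → List Bool
  motifAt k = motif k (start k)

  snoc-nonempty : ∀ (s : List Bool) b → 0 < length (s ++ b ∷ [])
  snoc-nonempty [] b = s≤s z≤n
  snoc-nonempty (_ ∷ s) b = s≤s z≤n

  start-< : ∀ k → start k < start (suc k)
  start-< k = m<m+n (start k) (snoc-nonempty (settle (requirements k (start k))) true)

  start-+ : ∀ m o → start m ≤ start (o + m)
  start-+ m zero = ≤-refl
  start-+ m (suc o) = ≤-trans (start-+ m o) (<⇒≤ (start-< (o + m)))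

  start-mono : ∀ {m n} → m ≤ n → start m ≤ start n
  start-mono {m} {n} m≤n = subst (λ q → start m ≤ start q) (m∸n+n≡m m≤n) (start-+ m (n ∸ m))

  start-≥ : ∀ k → k ≤ start k
  start-≥ zero = z≤n
  start-≥ (suc k) = ≤-trans (s≤s (start-≥ k)) (start-< k)

  place : ℕ → List Bool → Cantor
  place zero s = bit s
  place (suc L) s zero = false
  place (suc L) s (suc p) = place L s p

  place-at : ∀ L s i → place L s (L + i) ≡ bit s i
  place-at zero s i = refl
  place-at (suc L) s i = place-at L s i

  place-window : ∀ L s p → place L s p ≡ true → L ≤ p × p < L + length s
  place-window zero s p e = z≤n , bit-true s p e
  place-window (suc L) s (suc p) e with place-window L s p e
  ... | L≤p , p< = s≤s L≤p , s≤s p<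

  blockSet : ℕ → Cantor
  blockSet k = place (start k) (motifAt k)

  blockSet-window : ∀ k p → blockSet k p ≡ true → start k ≤ p × p < start (suc k)
  blockSet-window k = place-window (start k) (motifAt k)

  -- Windows are disjoint, so a point of window k lies in no other block.
  blockSet-unique : ∀ j k p → blockSet j p ≡ true → start k ≤ p → p < start (suc k) → j ≡ k
  blockSet-unique j k p e k≤p p<k' with blockSet-window j p e | <-cmp j k
  ... | _ , p<j' | tri< j<k _ _ = ⊥-elim (<-irrefl refl p<p)
    where p<p = <-≤-trans p<j' (≤-trans (start-mono j<k) k≤p)
  ... | _ | tri≈ _ j≡k _ = j≡k
  ... | j≤p , _ | tri> _ _ k<j = ⊥-elim (<-irrefl refl p<p)
    where p<p = <-≤-trans p<k' (≤-trans (start-mono k<j) j≤p)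

  blocks : Blocks ω
  blocks = record
    { block = blockSet
    ; bound = λ k → start (suc k)
    ; block⊆X = λ _ _ _ → refl
    ; block-above = λ k n e → ≤-trans (start-≥ k) (proj₁ (blockSet-window k n e))
    ; block-below = λ k n e → proj₂ (blockSet-window k n e)
    ; block-nonempty = λ k → start k + length (settle (requirements k (start k))) ,
        trans (place-at (start k) (motifAt k) _) (bit-last (settle (requirements k (start k))))
    }

  anyBelow : ℕ → (ℕ → Bool) → Bool
  anyBelow zero f = false
  anyBelow (suc n) f = f n ∨ anyBelow n f

  anyBelow-intro : ∀ n f k → k < n → f k ≡ true → anyBelow n f ≡ true
  anyBelow-intro (suc n) f k (s≤s k≤n) e with m≤n⇒m<n∨m≡n k≤n
  ... | inj₁ k<n = ∨-introʳ (anyBelow-intro n f k k<n e)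
  ... | inj₂ refl = ∨-introˡ e

  anyBelow-elim : ∀ n f → anyBelow n f ≡ true → ∃ λ k → f k ≡ true
  anyBelow-elim (suc n) f e with f n in fn
  ... | true = n , fn
  ... | false = anyBelow-elim n f e

  -- The union of all blocks (block k lies above k, so p can only be in blocks k ≤ p).
  covered : Cantor
  covered p = anyBelow (suc p) (λ k → blockSet k p)

  covered-intro : ∀ k p → blockSet k p ≡ true → covered p ≡ true
  covered-intro k p e = anyBelow-intro (suc p) (λ j → blockSet j p) k (s≤s (block-above blocks k p e)) e

  trace : ∀ x k → blockSet k ⊆ x → Extends (shift (start k) (x ∩ covered)) (motifAt k)
  trace x k sub = extends-bits _ (motifAt k) agree
    where
    agree : ∀ i → i < length (motifAt k) → (x ∩ covered) (start k + i) ≡ bit (motifAt k) i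
    agree i i< with bit (motifAt k) i in b
    ... | true = ∧-intro (sub _ inBlock) (covered-intro k _ inBlock)
      where
      inBlock : blockSet k (start k + i) ≡ true
      inBlock = trans (place-at (start k) (motifAt k) i) b
    ... | false = trans (cong (x (start k + i) ∧_) uncovered) (∧-zeroʳ _)
      where
      p = start k + i
      notInBlock : ∀ j → blockSet j p ≡ true → ⊥
      notInBlock j inJ with blockSet-unique j k p inJ (m≤m+n (start k) i) (+-monoʳ-< (start k) i<)
      ... | refl = true≢false (trans (sym inJ) (trans (place-at (start k) (motifAt k) i) b))
      uncovered : covered p ≡ false
      uncovered = ¬-not λ c →
        let (j , inJ) = anyBelow-elim (suc p) (λ j → blockSet j p) c in notInBlock j inJ

  trace-escapes : ∀ x j k → j ≤ k → blockSet k ⊆ x → ¬ F j (x ∩ covered)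
  trace-escapes x j k j≤k sub = settled z onSettling
    where
    z = x ∩ covered
    u = prefix z (start k)
    reqs = requirements k (start k)
    settled : Settles (u , j) (settle reqs)
    settled = All.lookup (settle-all reqs)
                (∈-cartesianProduct⁺ (prefix-∈-strings z (start k)) (∈-upTo⁺ (s≤s j≤k)))
    onMotif : Extends z (u ++ motifAt k)
    onMotif = extends-++ z u (motifAt k) (extends-prefix z (start k))
      (subst (λ m → Extends (shift m z) (motifAt k)) (sym (length-prefix z (start k))) (trace x k sub))
    onSettling : Extends z (u ++ settle reqs)
    onSettling = extends-++ˡ z (u ++ settle reqs) (true ∷ [])
      (subst (Extends z) (sym (++-assoc u (settle reqs) (true ∷ []))) onMotif)

  avoided : Avoids I ω blocks
  avoided x Ix _ cap =
    let Iz = downward x (x ∩ covered) (∩-⊆ˡ x covered) Ix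
        (j , zInF) = covers (x ∩ covered) (λ _ _ → refl) Iz
        (k , j≤k , sub) = cap j
    in trace-escapes x j k j≤k sub zInF

talagrand : ∀ I → DownwardClosed I → Meager I → Σ (Blocks ω) (Avoids I ω)
talagrand I downward meagerI = Talagrand.blocks I downward meagerI , Talagrand.avoided I downward meagerI

module Classical (lem : ExcludedMiddle (Level.suc 0ℓ)) where

  decide : (P : Set) → Dec P
  decide P with lem {Lift (Level.suc 0ℓ) P}
  ... | yes p = yes (lower p)
  ... | no ¬p = no (¬p ∘ lift)

  infinitely-or-eventually-not : (Q : ℕ → Set) → Infinitely Q ⊎ Eventually (λ k → ¬ Q k)
  infinitely-or-eventually-not Q with decide (Eventually (λ k → ¬ Q k))
  ... | yes ev = inj₂ ev
  ... | no ¬ev = inj₁ many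
    where
    many : Infinitely Q
    many N with decide (∃ λ k → N ≤ k × Q k)
    ... | yes found = found
    ... | no none = ⊥-elim (¬ev (N , λ k N≤k q → none (k , N≤k , q)))

  avoided-meager : ∀ {X} (S : Blocks X) (Q : PSet) →
                   (∀ x → x ⊆ X → Q x → ¬ Captures S x) → MeagerIn X Q
  avoided-meager {X} S Q uncaptured = MissesFrom S , missesFrom-nowhereDense S , cover
    where
    cover : ∀ x → x ⊆ X → Q x → ∃ λ N → MissesFrom S N x
    cover x x⊆X q with infinitely-or-eventually-not (λ k → block S k ⊆ x)
    ... | inj₁ cap = ⊥-elim (uncaptured x x⊆X q cap)
    ... | inj₂ misses = misses

  avoided-hull-meager : ∀ I {X} (S : Blocks X) → Avoids I X S → (Q : PSet) → Q ⊑ Hull I → MeagerIn X Q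
  avoided-hull-meager I S avoids Q Q⊑hull = avoided-meager S Q λ x x⊆X q cap →
    avoided-not-captured I S x avoids x⊆X cap (Q⊑hull x q)

  hull-hereditaryMeager : ∀ I → HereditaryMeager (Hull I)
  hull-hereditaryMeager I X X∉ with decide (Σ (Blocks X) (Avoids I X))
  ... | yes (S , avoids) = avoided-hull-meager I S avoids (Restrict (Hull I) X) (λ _ → proj₁)
  ... | no none = ⊥-elim (X∉ λ S avoids → none (S , avoids))

  hull-meager : ∀ I → DownwardClosed I → Meager I → Meager (Hull I)
  hull-meager I downward meagerI =
    let (S , avoids) = talagrand I downward meagerI in avoided-hull-meager I S avoids (Hull I) (λ _ h → h)

  -- Union: let I avoid S in A ∪ B.  If eventually no block meets A, then B captures
  -- S, contradicting the key fact.  Otherwise, any x ∈ I inside A capturing the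
  -- A-parts of S gives a contradiction: if infinitely many of those blocks also meet
  -- B, a y ∈ I inside B capturing their B-parts makes x ∪ y capture S; otherwise
  -- those blocks eventually lie in A, so x captures S.
  hull-∪ : ∀ I → IsIdeal I → ∀ A B → Hull I A → Hull I B → Hull I (A ∪ B)
  hull-∪ I isI A B hullA hullB S avoids with infinitely-or-eventually-not (λ k → Meets (block S k) A)
  ... | inj₂ (M , missA) = avoided-not-captured I S B avoids (⊆-∪ʳ A B) (eventually⇒infinitely (M , inB)) hullB
    where
    inB : ∀ k → M ≤ k → block S k ⊆ B
    inB k M≤k = misses-⊆ B A (∪-swap A B (block⊆X S k)) (missA k M≤k)
  ... | inj₁ meetA = hullA SA avoidsA
    where
    open IsIdeal isI
    SA = restrict S A meetA (λ m → m)
    Mixed : Cantor → ℕ → Set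
    Mixed x k = (block S k ∩ A) ⊆ x × Meets (block S k) B
    avoidsA : Avoids I A SA
    avoidsA x Ix x⊆A capX with infinitely-or-eventually-not (Mixed x)
    ... | inj₁ mixed = hullB SB avoidsB
      where
      SB = restrict S B mixed proj₂
      avoidsB : Avoids I B SB
      avoidsB y Iy y⊆B capY = avoids (x ∪ y) (unionClosed x y Ix Iy) (∪-mono x⊆A y⊆B)
        (infinitely-map (λ {k} ((inx , _) , iny) → ∪-split A B (block⊆X S k) inx iny)
          (restrict-captured S B mixed proj₂ capY))
    ... | inj₂ unmixed = avoids x Ix (⊆-trans x⊆A (⊆-∪ˡ A B))
      (infinitely-map inX (infinitely-∩-eventually partsInX unmixed))
      where
      partsInX : Infinitely (λ k → (block S k ∩ A) ⊆ x)
      partsInX = infinitely-map proj₂ (restrict-captured S A meetA (λ m → m) capX)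
      inX : ∀ {k} → (block S k ∩ A) ⊆ x × ¬ Mixed x k → block S k ⊆ x
      inX {k} (part , notMixed) =
        ∩-⊆-whole (misses-⊆ A B (block⊆X S k) (notMixed ∘ (part ,_))) part

  hull-isIdeal : ∀ I → IsIdeal I → Meager I → IsIdeal (Hull I)
  hull-isIdeal I isI meagerI = record
    { downward = hull-downward I downward
    ; unionClosed = hull-∪ I isI
    ; finiteSets = hull-finite I
    ; proper = λ hullω → let (S , avoids) = talagrand I downward meagerI in hullω S avoids
    }
    where open IsIdeal isI

  Φ : MIdeal → MIdeal
  Φ I = record
    { carrier = Hull (carrier I)
    ; isIdeal = hull-isIdeal (carrier I) (isIdeal I) (meager I)
    ; meager = hull-meager (carrier I) (IsIdeal.downward (isIdeal I)) (meager I)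
    }

mainTheorem7 : ExcludedMiddle (Level.suc 0ℓ) →
    Σ (MIdeal → MIdeal) λ Φ →
    ∀ (I : MIdeal) →
    HereditaryMeager (carrier (Φ I)) × (carrier I ⊑ carrier (Φ I)) × (Φ I ≈sep I)
mainTheorem7 lem = Φ , λ I →
  hull-hereditaryMeager (carrier I) ,
  hull-⊇ (carrier I) ,
  ≈sep-of-closure Φ (hull-⊇ ∘ carrier) (λ _ _ → hull-mono) I
  where open Classical lem
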